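{- Let $(F_n)_{n\ge 0}$ be the Fibonacci sequence, $F_0=0$, $F_1=1$, $F_n=F_{n-1}+F_{n-2}$ for $n\ge 2$, and let $N$ be a positive integer. If $F$ is a Fibonacci number with at least $N+2$ decimal digits, then for every $M\in\{1,2,\dots,N\}$ and every integer $d$ with $0\le d\le 10^M-1$, the number $10^MF+d$ is not a Fibonacci number. That is, one cannot append $1,2,\dots,$ or $N$ digits to the right of $F$ to obtain another Fibonacci number.
   Context: Appending $M$ digits to a number $a$ means forming $10^M a+d$ with $0\le d\le 10^M-1$ (leading zeros allowed). -}

module Defs where

open import Data.Nat using (ℕ; zero; suc; _+_)

fib : ℕ → ℕ
fib zero = 0
fib (suc zero) = 1
fib (suc (suc n)) = fib (suc n) + fib n

-- Let F = F(k) and p = 10^M, so that 10 p ≤ F, and suppose F(m) = p F + d with d < p.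
-- Since F(k+1) ≤ 2F < p F, we have m ≥ k + 2, and since F(2k) = L(k) F ≥ F² > p F + d,
-- we have m < 2k. Writing m = k + j and k = j + r, the Lucas identity
-- F(k+j) = L(j) F(k) − (−1)^j F(r), with F(r) ≤ F/2 and d < F/2, forces p = L(j)
-- by uniqueness of the quotient on division by F. But 5 divides p and no Lucas number.
module Submission where

open import Defs
open import Data.Empty using (⊥)
open import Data.List using ([]; _∷_)
open import Data.Nat using (ℕ; zero; suc; _+_; _*_; _∸_; _^_; _%_; _/_; _≤_; _<_; _≤′_; ≤′-refl; ≤′-step; z≤n; s≤s; NonZero; >-nonZero)
open import Data.Nat.Properties
open import Data.Nat.DivMod using (%-distribˡ-+; m%n<n; +-distrib-/-∣ˡ; m*n/n≡m; m<n⇒m/n≡0)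
open import Data.Nat.Divisibility using (_∣_; divides; ∣m⇒∣m*n; n∣m⇒m%n≡0)
open import Data.Nat.Tactic.RingSolver using (solve)
open import Data.Product using (∃; ∃₂; _×_; _,_)
open import Relation.Binary.PropositionalEquality using (_≡_; _≢_; refl; sym; trans; cong; cong₂; subst; module ≡-Reasoning)
open import Relation.Nullary using (¬_; Dec; yes; no)

luc : ℕ → ℕ
luc zero = 2
luc (suc zero) = 1
luc (suc (suc n)) = luc (suc n) + luc n

fib-≤-suc : ∀ n → fib n ≤ fib (suc n)
fib-≤-suc zero = z≤n
fib-≤-suc (suc zero) = ≤-refl
fib-≤-suc (suc (suc n)) = m≤m+n (fib (suc (suc n))) (fib (suc n))

fib-mono-≤′ : ∀ {m n} → m ≤′ n → fib m ≤ fib n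
fib-mono-≤′ ≤′-refl = ≤-refl
fib-mono-≤′ (≤′-step {n} m≤′n) = ≤-trans (fib-mono-≤′ m≤′n) (fib-≤-suc n)

fib-mono : ∀ {m n} → m ≤ n → fib m ≤ fib n
fib-mono m≤n = fib-mono-≤′ (≤⇒≤′ m≤n)

fib-suc-≤-twice : ∀ {n} → 1 ≤ fib n → fib (suc n) ≤ 2 * fib n
fib-suc-≤-twice {suc n} _ = +-monoʳ-≤ (fib (suc n)) (≤-trans (fib-≤-suc n) (m≤m+n _ 0))

fib-twice-≤ : ∀ n → fib n + fib n ≤ fib (suc (suc n))
fib-twice-≤ n = +-monoˡ-≤ (fib n) (fib-≤-suc n)

fib≤luc : ∀ n → fib n ≤ luc n
fib≤luc zero = z≤n
fib≤luc (suc zero) = ≤-refl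
fib≤luc (suc (suc n)) = +-mono-≤ (fib≤luc (suc n)) (fib≤luc n)

m%2+[1+m]%2≡1 : ∀ m → m % 2 + suc m % 2 ≡ 1
m%2+[1+m]%2≡1 zero = refl
m%2+[1+m]%2≡1 (suc zero) = refl
m%2+[1+m]%2≡1 (suc (suc m)) = m%2+[1+m]%2≡1 m

-- Adding 2 f₁ to both sides lets the two parity corrections combine, as p + q = 1.
lucas-step : ∀ {a₁ a₀ f₁ f₀ l₁ l₀ x} p q → p + q ≡ 1 →
  a₁ + f₁ ≡ l₁ * x + 2 * q * f₁ →
  a₀ + (f₁ + f₀) ≡ l₀ * x + 2 * p * (f₁ + f₀) →
  a₁ + a₀ + f₀ ≡ (l₁ + l₀) * x + 2 * p * f₀
lucas-step {a₁} {a₀} {f₁} {f₀} {l₁} {l₀} {x} p q p+q≡1 h₁ h₀ =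
  +-cancelʳ-≡ (2 * f₁) _ _ (begin
    a₁ + a₀ + f₀ + 2 * f₁
      ≡⟨ solve (a₁ ∷ a₀ ∷ f₁ ∷ f₀ ∷ []) ⟩
    (a₁ + f₁) + (a₀ + (f₁ + f₀))
      ≡⟨ cong₂ _+_ h₁ h₀ ⟩
    (l₁ * x + 2 * q * f₁) + (l₀ * x + 2 * p * (f₁ + f₀))
      ≡⟨ solve (l₁ ∷ l₀ ∷ x ∷ p ∷ q ∷ f₁ ∷ f₀ ∷ []) ⟩
    (l₁ + l₀) * x + 2 * p * f₀ + 2 * (p + q) * f₁
      ≡⟨ cong (λ s → (l₁ + l₀) * x + 2 * p * f₀ + 2 * s * f₁) p+q≡1 ⟩
    (l₁ + l₀) * x + 2 * p * f₀ + 2 * f₁ ∎)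
  where open ≡-Reasoning

-- F(k+j) + (−1)^j F(k−j) = L(j) F(k) for k = j + r, the sign encoded by j % 2
-- so that no subtraction occurs.
lucas-identity : ∀ j r →
  fib (j + (j + r)) + fib r ≡ luc j * fib (j + r) + 2 * (j % 2) * fib r
lucas-identity zero r = x+x≡2x (fib r)
  where
  x+x≡2x : ∀ x → x + x ≡ 2 * x + 2 * 0 * x
  x+x≡2x x = solve (x ∷ [])
lucas-identity (suc zero) r = x+y+y≡x+2y (fib (suc r)) (fib r)
  where
  x+y+y≡x+2y : ∀ x y → x + y + y ≡ 1 * x + 2 * 1 * y
  x+y+y≡x+2y x y = solve (x ∷ y ∷ [])
lucas-identity (suc (suc j)) r =
  lucas-step {l₁ = luc (suc j)} {luc j} {fib (suc (suc (j + r)))}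
    (j % 2) (suc j % 2) (m%2+[1+m]%2≡1 j)
    (subst (λ n → fib (suc (j + suc n)) + fib (suc r)
                ≡ luc (suc j) * fib (suc n) + 2 * (suc j % 2) * fib (suc r))
           (+-suc j r) (lucas-identity (suc j) (suc r)))
    (subst (λ n → fib (j + n) + fib (suc (suc r))
                ≡ luc j * fib n + 2 * (j % 2) * fib (suc (suc r)))
           (trans (+-suc j (suc r)) (cong suc (+-suc j r))) (lucas-identity j (suc (suc r))))

fib-double : ∀ n → fib (n + n) ≡ luc n * fib n
fib-double n = begin
  fib (n + n)                                      ≡⟨ sym (+-identityʳ _) ⟩
  fib (n + n) + 0                                  ≡⟨ cong (λ m → fib (n + m) + 0) (sym (+-identityʳ n)) ⟩
  fib (n + (n + 0)) + fib 0                        ≡⟨ lucas-identity n 0 ⟩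
  luc n * fib (n + 0) + 2 * (n % 2) * 0            ≡⟨ cong₂ (λ m z → luc n * fib m + z) (+-identityʳ n) (*-zeroʳ (2 * (n % 2))) ⟩
  luc n * fib n + 0                                ≡⟨ +-identityʳ _ ⟩
  luc n * fib n                                    ∎
  where open ≡-Reasoning

fib-square-≤ : ∀ n → fib n * fib n ≤ fib (n + n)
fib-square-≤ n = ≤-trans (*-monoˡ-≤ (fib n) (fib≤luc n)) (≤-reflexive (sym (fib-double n)))

data LucasResidues : ℕ → ℕ → Set where
  l₀ : LucasResidues 2 1
  l₁ : LucasResidues 1 3
  l₂ : LucasResidues 3 4
  l₃ : LucasResidues 4 2

lucas-residues-step : ∀ {a b} → LucasResidues a b → LucasResidues b ((b + a) % 5)
lucas-residues-step l₀ = l₁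
lucas-residues-step l₁ = l₂
lucas-residues-step l₂ = l₃
lucas-residues-step l₃ = l₀

lucas-residues : ∀ n → LucasResidues (luc n % 5) (luc (suc n) % 5)
lucas-residues zero = l₀
lucas-residues (suc n) =
  subst (LucasResidues _) (sym (%-distribˡ-+ (luc (suc n)) (luc n) 5))
        (lucas-residues-step (lucas-residues n))

lucas-residue-nonzero : ∀ {a b} → LucasResidues a b → a ≢ 0
lucas-residue-nonzero l₀ ()
lucas-residue-nonzero l₁ ()
lucas-residue-nonzero l₂ ()
lucas-residue-nonzero l₃ ()

5∤luc : ∀ n → ¬ 5 ∣ luc n
5∤luc n 5∣luc = lucas-residue-nonzero (lucas-residues n) (n∣m⇒m%n≡0 (luc n) 5 5∣luc)

5∣10^[1+n] : ∀ n → 5 ∣ 10 ^ suc n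
5∣10^[1+n] n = ∣m⇒∣m*n (10 ^ n) (divides 2 refl)

[m*n+o]/n≡m : ∀ m {n o} .{{_ : NonZero n}} → o < n → (m * n + o) / n ≡ m
[m*n+o]/n≡m m {n} {o} o<n = begin
  (m * n + o) / n       ≡⟨ +-distrib-/-∣ˡ o (divides m refl) ⟩
  m * n / n + o / n     ≡⟨ cong₂ _+_ (m*n/n≡m m n) (m<n⇒m/n≡0 o<n) ⟩
  m + 0                 ≡⟨ +-identityʳ m ⟩
  m                     ∎
  where open ≡-Reasoning

quotient-unique : ∀ {m m′ n o o′} → o < n → o′ < n → m * n + o ≡ m′ * n + o′ → m ≡ m′
quotient-unique {m} {m′} {n} {o} {o′} o<n o′<n eq = begin
  m                 ≡⟨ sym ([m*n+o]/n≡m m o<n) ⟩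
  (m * n + o) / n   ≡⟨ cong (_/ n) eq ⟩
  (m′ * n + o′) / n ≡⟨ [m*n+o]/n≡m m′ o′<n ⟩
  m′                ∎
  where
  open ≡-Reasoning
  instance
    n≢0 : NonZero n
    n≢0 = >-nonZero (≤-<-trans z≤n o<n)

m+m<n+n⇒m<n : ∀ {m n} → m + m < n + n → m < n
m+m<n+n⇒m<n m+m<n+n = ≰⇒> (λ n≤m → <⇒≱ m+m<n+n (+-mono-≤ n≤m n≤m))

fib-below : ∀ {k m p} → 2 < p → 0 < fib k → m ≤ suc k → fib m < p * fib k
fib-below {k} 2<p 0<F m≤1+k =
  ≤-<-trans (≤-trans (fib-mono m≤1+k) (fib-suc-≤-twice {k} 0<F))
            (*-monoˡ-< (fib k) {{>-nonZero 0<F}} 2<p)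

fib-above : ∀ {k m p d} → p < fib k → d < fib k → k + k ≤ m → p * fib k + d < fib m
fib-above {k} {m} {p} {d} p<F d<F k+k≤m = begin-strict
  p * F + d     <⟨ +-monoʳ-< (p * F) d<F ⟩
  p * F + F     ≡⟨ +-comm (p * F) F ⟩
  suc p * F     ≤⟨ *-monoˡ-≤ F p<F ⟩
  F * F         ≤⟨ fib-square-≤ k ⟩
  fib (k + k)   ≤⟨ fib-mono k+k≤m ⟩
  fib m         ∎
  where
  open ≤-Reasoning
  F = fib k

fib-between : ∀ {k m p d} j r → 2 ≤ j → j + r ≡ k → j + k ≡ m → 5 ∣ p → d + d < fib k →
  fib m ≢ p * fib k + d
fib-between {p = p} {d} j r 2≤j refl refl 5∣p d+d<F eq = 5∤luc j (subst (5 ∣_) p≡L 5∣p)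
  where
  F = fib (j + r)
  Fr = fib r
  Fr+Fr≤F : Fr + Fr ≤ F
  Fr+Fr≤F = ≤-trans (fib-twice-≤ r) (fib-mono (+-monoˡ-≤ r 2≤j))
  d+Fr<F : d + Fr < F
  d+Fr<F = m+m<n+n⇒m<n (subst (_< F + F) (interchange d Fr) (+-mono-<-≤ d+d<F Fr+Fr≤F))
    where
    interchange : ∀ x y → x + x + (y + y) ≡ x + y + (x + y)
    interchange x y = solve (x ∷ y ∷ [])
  d<F : d < F
  d<F = ≤-<-trans (m≤m+n d Fr) d+Fr<F
  Fr<F : Fr < F
  Fr<F = ≤-<-trans (m≤n+m Fr d) d+Fr<F
  shifted : p * F + d + Fr ≡ luc j * F + 2 * (j % 2) * Fr
  shifted = trans (cong (_+ Fr) (sym eq)) (lucas-identity j r)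
  p≡L : p ≡ luc j
  p≡L with j % 2 | shifted | m%n<n j 2
  ... | 0 | even | _ = quotient-unique d+Fr<F (≤-<-trans z≤n d+Fr<F) (trans (sym (+-assoc _ d Fr)) even)
  ... | 1 | odd  | _ = quotient-unique d<F Fr<F (+-cancelʳ-≡ Fr _ _ (trans odd (regroup (luc j * F) Fr)))
    where
    regroup : ∀ x y → x + 2 * 1 * y ≡ x + y + y
    regroup x y = solve (x ∷ y ∷ [])
  ... | suc (suc _) | _ | s≤s (s≤s ())

middle-range : ∀ {k m} → suc k < m → m < k + k → ∃₂ λ j r → 2 ≤ j × j + r ≡ k × j + k ≡ m
middle-range {k} {m} 1+k<m m<k+k =
  m ∸ k , k ∸ (m ∸ k) , m+n≤o⇒m≤o∸n 2 1+k<m , m+[n∸m]≡n (<⇒≤ j<k) , m∸n+n≡m k≤m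
  where
  k≤m : k ≤ m
  k≤m = m+n≤o⇒n≤o 2 1+k<m
  j<k : m ∸ k < k
  j<k = subst (m ∸ k <_) (m+n∸n≡m k k) (∸-monoˡ-< m<k+k k≤m)

no-fib-after-appending : ∀ {k p d} → 2 < p → 5 ∣ p → p + p ≤ fib k → d < p →
  ∀ m → fib m ≢ p * fib k + d
no-fib-after-appending {k} {p} {d} 2<p 5∣p p+p≤F d<p m fib-m≡ =
  by-position (m ≤? suc k) (k + k ≤? m)
  where
  p<F : p < fib k
  p<F = <-≤-trans (m<m+n p (≤-<-trans z≤n 2<p)) p+p≤F
  by-position : Dec (m ≤ suc k) → Dec (k + k ≤ m) → ⊥
  by-position (yes m≤1+k) _ =
    <⇒≱ (fib-below 2<p (≤-<-trans z≤n p<F) m≤1+k) (≤-trans (m≤m+n _ d) (≤-reflexive (sym fib-m≡)))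
  by-position (no _) (yes k+k≤m) = <-irrefl (sym fib-m≡) (fib-above {k} p<F (<-trans d<p p<F) k+k≤m)
  by-position (no m≰1+k) (no k+k≰m) =
    let j , r , 2≤j , j+r≡k , j+k≡m = middle-range (≰⇒> m≰1+k) (≰⇒> k+k≰m)
    in fib-between j r 2≤j j+r≡k j+k≡m 5∣p (<-≤-trans (+-mono-< d<p d<p) p+p≤F) fib-m≡

corollary2p6 : (N : ℕ) → 1 ≤ N → (k : ℕ) → 10 ^ (N + 1) ≤ fib k →
    (M : ℕ) → 1 ≤ M → M ≤ N → (d : ℕ) → d < 10 ^ M →
    ¬ (∃ λ m → fib m ≡ 10 ^ M * fib k + d)
corollary2p6 N _ k 10^[N+1]≤F (suc M) _ 1+M≤N d d<p (m , fib-m≡) =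
  no-fib-after-appending {k} (≤-trans (s≤s (s≤s (s≤s z≤n))) 10≤p) (5∣10^[1+n] M) p+p≤F d<p m fib-m≡
  where
  p = 10 ^ suc M
  10≤p : 10 ≤ p
  10≤p = ^-monoʳ-≤ 10 {1} {suc M} (s≤s z≤n)
  10p≤F : 10 * p ≤ fib k
  10p≤F = ≤-trans (^-monoʳ-≤ 10 (s≤s 1+M≤N)) (subst (λ e → 10 ^ e ≤ fib k) (+-comm N 1) 10^[N+1]≤F)
  p+p≤F : p + p ≤ fib k
  p+p≤F = ≤-trans (+-monoʳ-≤ p (m≤m+n p (8 * p))) 10p≤F
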